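{- Let $n\ge 3$, let $G_1,G_2$ be disjoint copies of $C_n$ with vertices $u_1,\dots,u_n$ and $v_1,\dots,v_n$ labeled cyclically, and let $id$ be the map $u_i\mapsto v_i$. Then (1) $\gamma(C(C_n,id))=\gamma(C_n)$ if and only if $n=4$; (2) $\gamma(C(C_n,id))=2\gamma(C_n)$ if and only if $n=3$ or $n=6$.
   Context: For disjoint copies $G_1,G_2$ of a graph $G$ and a function $f:V(G_1)\to V(G_2)$, the functigraph $C(G,f)$ has vertex set $V(G_1)\cup V(G_2)$ and edge set $E(G_1)\cup E(G_2)\cup\{uv : u\in V(G_1), v\in V(G_2), v=f(u)\}$. $\gamma$ denotes domination number. -}

module Defs where

open import Data.Nat using (ℕ; _+_; _≤_; suc)
open import Data.Fin using (Fin; toℕ; splitAt)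
open import Data.Fin.Subset using (Subset; _∈_; ∣_∣)
open import Data.Sum using (_⊎_; inj₁; inj₂)
open import Data.Product using (Σ; _×_; ∃)
open import Data.Empty using (⊥)
open import Relation.Binary.PropositionalEquality using (_≡_)
open import Relation.Nullary using (¬_)

-- The cycle C_n on vertices 0,…,n-1 (labels u_1..u_n shifted to 0..n-1), i ~ i+1 mod n.
-- (Only intended for n ≥ 3.)
CycleAdj : (n : ℕ) → Fin n → Fin n → Set
CycleAdj n i j = Succ i j ⊎ Succ j i
  where
  Succ : Fin n → Fin n → Set
  Succ a b = (toℕ b ≡ suc (toℕ a)) ⊎ ((suc (toℕ a) ≡ n) × (toℕ b ≡ 0))

-- Functigraph C(G,f) on Fin (N + N): the first N vertices are G₁, the last N are G₂;
-- G₁ and G₂ carry G's edges, plus edges u – f(u) for u ∈ G₁.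
FunctiAdj : {N : ℕ} → (Fin N → Fin N → Set) → (Fin N → Fin N) →
            Fin (N + N) → Fin (N + N) → Set
FunctiAdj {N} A f x y with splitAt N x | splitAt N y
... | inj₁ a | inj₁ b = A a b
... | inj₂ a | inj₂ b = A a b
... | inj₁ a | inj₂ b = f a ≡ b
... | inj₂ a | inj₁ b = f b ≡ a

Dominating : {N : ℕ} → (Fin N → Fin N → Set) → Subset N → Set
Dominating {N} A S = ∀ (x : Fin N) → (x ∈ S) ⊎ ∃ (λ y → (y ∈ S) × A x y)

IsDominationNumber : {N : ℕ} → (Fin N → Fin N → Set) → ℕ → Set
IsDominationNumber {N} A k =
  Σ (Subset N) (λ S → Dominating A S × ∣ S ∣ ≡ k) ×
  (∀ (S : Subset N) → Dominating A S → k ≤ ∣ S ∣)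

-- A vertex of C_n has two neighbours and a vertex of the prism C(C_n, id) = C_n □ K₂ has three,
-- so a dominating set reaches at most 3 (resp. 4) vertices per element: n ≤ 3 γ(C_n) and
-- n ≤ 2 γ(C(C_n, id)). Periodic patterns (the residues 1 mod 3 on the cycle; 0 mod 4 on one copy
-- and 2 mod 4 on the other, with position n folded onto 0) give 3 γ(C_n) ≤ n + 2 and
-- 2 γ(C(C_n, id)) ≤ n + 2. These four inequalities allow γ(C(C_n, id)) = γ(C_n) only for n = 4 and
-- γ(C(C_n, id)) = 2 γ(C_n) only for n ∈ {3, 6}, and pin down both numbers there, except that
-- γ(C(C_6, id)) ≥ 4 needs an exhaustive search.

module Submission where

open import Defs
open import Data.Bool using (Bool; true; false; T; _∨_)
open import Data.Bool.Properties using (T-∨)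
open import Data.Empty using (⊥-elim)
open import Data.Fin using (Fin; zero; suc; toℕ; fromℕ<; splitAt; join; _↑ˡ_; _↑ʳ_; combine)
open import Data.Fin.Properties
  using (all?; any?; toℕ-injective; toℕ<n; toℕ-fromℕ<; splitAt-↑ˡ; splitAt-↑ʳ; join-splitAt;
         combine-injectiveˡ; combine-injectiveʳ; injective⇒≤)
import Data.Fin.Properties as Fin
open import Data.Fin.Subset using (Subset; _∈_; ∣_∣)
open import Data.Fin.Subset.Properties using (_∈?_; anySubset?)
open import Data.Nat using (ℕ; zero; suc; _+_; _*_; _≤_; _<_; z≤n; s≤s)
open import Data.Nat.Properties
  using (suc-injective; <-irrefl; <-trans; n<1+n; m≤n⇒m<n∨m≡n; ≤-refl; +-assoc; +-comm; +-monoˡ-≤;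
         +-monoʳ-≤; ≤-trans; ≤-reflexive; *-suc; n≤1+n; +-suc; *-distribˡ-+; *-monoʳ-≤; +-mono-≤; *-comm;
         *-cancelˡ-≤; *-cancelˡ-<; +-identityʳ; *-assoc; +-cancelʳ-≤; ≤-antisym; <-≤-trans; ≰⇒>; m≤m+n;
         _≟_; _≤?_; module ≤-Reasoning)
open import Data.Product using (_×_; _,_; ∃)
open import Data.Sum using (_⊎_; inj₁; inj₂; map₁)
open import Data.Vec using ([]; _∷_; _++_; here; there)
open import Function.Bundles using (_⇔_; mk⇔; Equivalence)
open import Function.Base using (id)
open import Function.Definitions using (Injective)
open import Relation.Binary.Definitions using (Decidable)
open import Relation.Nullary using (Dec; ¬_)
open import Relation.Nullary.Decidable using (_⊎-dec_; _×-dec_; from-no)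
open import Relation.Binary.PropositionalEquality
  using (_≡_; refl; sym; trans; cong; subst; module ≡-Reasoning)

DominatedBy : {N : ℕ} → (Fin N → Fin N → Set) → Subset N → Fin N → Set
DominatedBy A S x = (x ∈ S) ⊎ ∃ (λ y → (y ∈ S) × A x y)

-- Each vertex y has at most d neighbours x, told apart by the port of the edge.
record PortNumbering {N : ℕ} (A : Fin N → Fin N → Set) (d : ℕ) : Set where
  field
    port : ∀ {x y} → A x y → Fin d
    port-injective : ∀ {x x′ y} (a : A x y) (a′ : A x′ y) → port a ≡ port a′ → x ≡ x′

position : ∀ {N} (S : Subset N) {x} → x ∈ S → Fin ∣ S ∣
position (true ∷ S) here = zero
position (true ∷ S) (there x∈S) = suc (position S x∈S)
position (false ∷ S) (there x∈S) = position S x∈S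

position-injective : ∀ {N} (S : Subset N) {x y} (x∈S : x ∈ S) (y∈S : y ∈ S) →
                     position S x∈S ≡ position S y∈S → x ≡ y
position-injective (true ∷ S) here here _ = refl
position-injective (true ∷ S) (there x∈S) (there y∈S) eq =
  cong suc (position-injective S x∈S y∈S (Fin.suc-injective eq))
position-injective (false ∷ S) (there x∈S) (there y∈S) eq =
  cong suc (position-injective S x∈S y∈S eq)

-- A vertex is coded by a dominator together with either 0 (itself) or 1 + the port of the edge.
dominating⇒≤[1+d]*∣S∣ : ∀ {N d} {A : Fin N → Fin N → Set} {S : Subset N} →
                         PortNumbering A d → Dominating A S → N ≤ suc d * ∣ S ∣
dominating⇒≤[1+d]*∣S∣ {N} {d} {A} {S} ports dom =
  ≤-trans (injective⇒≤ code-injective) (≤-reflexive (*-comm ∣ S ∣ (suc d)))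
  where
  open PortNumbering ports

  code : Fin N → Fin (∣ S ∣ * suc d)
  code x with dom x
  ... | inj₁ x∈S = combine (position S x∈S) zero
  ... | inj₂ (y , y∈S , a) = combine (position S y∈S) (suc (port a))

  code-injective : Injective _≡_ _≡_ code
  code-injective {x} {x′} eq with dom x | dom x′
  ... | inj₁ x∈S | inj₁ x′∈S =
    position-injective S x∈S x′∈S (combine-injectiveˡ _ zero _ zero eq)
  ... | inj₁ x∈S | inj₂ (y′ , y′∈S , a′)
    with () ← combine-injectiveʳ (position S x∈S) zero (position S y′∈S) _ eq
  ... | inj₂ (y , y∈S , a) | inj₁ x′∈S
    with () ← combine-injectiveʳ (position S y∈S) _ (position S x′∈S) zero eq
  ... | inj₂ (y , y∈S , a) | inj₂ (y′ , y′∈S , a′)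
    with refl ← position-injective S y∈S y′∈S (combine-injectiveˡ _ _ _ _ eq)
    = port-injective a a′
        (Fin.suc-injective (combine-injectiveʳ (position S y∈S) _ (position S y′∈S) _ eq))

-- CycleAdj n i j unfolds to Successor n i j ⊎ Successor n j i.
Successor : (n : ℕ) → Fin n → Fin n → Set
Successor n a b = (toℕ b ≡ suc (toℕ a)) ⊎ ((suc (toℕ a) ≡ n) × (toℕ b ≡ 0))

successor-injectiveˡ : ∀ {n} {a a′ b : Fin n} → Successor n a b → Successor n a′ b → a ≡ a′
successor-injectiveˡ (inj₁ b≡1+a) (inj₁ b≡1+a′) =
  toℕ-injective (suc-injective (trans (sym b≡1+a) b≡1+a′))
successor-injectiveˡ (inj₁ b≡1+a) (inj₂ (_ , b≡0)) with () ← trans (sym b≡1+a) b≡0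
successor-injectiveˡ (inj₂ (_ , b≡0)) (inj₁ b≡1+a′) with () ← trans (sym b≡1+a′) b≡0
successor-injectiveˡ (inj₂ (1+a≡n , _)) (inj₂ (1+a′≡n , _)) =
  toℕ-injective (suc-injective (trans 1+a≡n (sym 1+a′≡n)))

successor-injectiveʳ : ∀ {n} {a b b′ : Fin n} → Successor n a b → Successor n a b′ → b ≡ b′
successor-injectiveʳ (inj₁ b≡1+a) (inj₁ b′≡1+a) = toℕ-injective (trans b≡1+a (sym b′≡1+a))
successor-injectiveʳ {b = b} (inj₁ b≡1+a) (inj₂ (1+a≡n , _)) =
  ⊥-elim (<-irrefl (trans b≡1+a 1+a≡n) (toℕ<n b))
successor-injectiveʳ {b′ = b′} (inj₂ (1+a≡n , _)) (inj₁ b′≡1+a) =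
  ⊥-elim (<-irrefl (trans b′≡1+a 1+a≡n) (toℕ<n b′))
successor-injectiveʳ (inj₂ (_ , b≡0)) (inj₂ (_ , b′≡0)) = toℕ-injective (trans b≡0 (sym b′≡0))

cycle-ports : ∀ n → PortNumbering (CycleAdj n) 2
cycle-ports n = record { port = port ; port-injective = port-injective }
  where
  port : ∀ {x y} → CycleAdj n x y → Fin 2
  port (inj₁ _) = zero
  port (inj₂ _) = suc zero

  port-injective : ∀ {x x′ y} (a : CycleAdj n x y) (a′ : CycleAdj n x′ y) → port a ≡ port a′ → x ≡ x′
  port-injective (inj₁ s) (inj₁ s′) _ = successor-injectiveˡ s s′
  port-injective (inj₂ s) (inj₂ s′) _ = successor-injectiveʳ s s′

splitAt-injective : ∀ m {n} {x y : Fin (m + n)} → splitAt m x ≡ splitAt m y → x ≡ y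
splitAt-injective m {n} {x} {y} eq =
  trans (sym (join-splitAt m n x)) (trans (cong (join m n) eq) (join-splitAt m n y))

functigraph-ports : ∀ {N d} {A : Fin N → Fin N → Set} {f : Fin N → Fin N} →
                    PortNumbering A d → Injective _≡_ _≡_ f → PortNumbering (FunctiAdj A f) (suc d)
functigraph-ports {N} {d} {A} {f} ports f-injective =
  record { port = port′ ; port-injective = port′-injective }
  where
  open PortNumbering ports

  port′ : ∀ {x y} → FunctiAdj A f x y → Fin (suc d)
  port′ {x} {y} a with splitAt N x | splitAt N y
  ... | inj₁ _ | inj₁ _ = suc (port a)
  ... | inj₂ _ | inj₂ _ = suc (port a)
  ... | inj₁ _ | inj₂ _ = zero
  ... | inj₂ _ | inj₁ _ = zero

  same : ∀ {x x′ : Fin (N + N)} {p p′} → splitAt N x ≡ p → splitAt N x′ ≡ p′ → p ≡ p′ → x ≡ x′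
  same ex ex′ p≡p′ = splitAt-injective N (trans ex (trans p≡p′ (sym ex′)))

  port′-injective : ∀ {x x′ y} (a : FunctiAdj A f x y) (a′ : FunctiAdj A f x′ y) →
                    port′ a ≡ port′ a′ → x ≡ x′
  port′-injective {x} {x′} {y} a a′ eq
    with splitAt N x in ex | splitAt N x′ in ex′ | splitAt N y
  ... | inj₁ u | inj₁ u′ | inj₁ _ = same ex ex′ (cong inj₁ (port-injective a a′ (Fin.suc-injective eq)))
  ... | inj₂ u | inj₂ u′ | inj₂ _ = same ex ex′ (cong inj₂ (port-injective a a′ (Fin.suc-injective eq)))
  ... | inj₁ u | inj₁ u′ | inj₂ _ = same ex ex′ (cong inj₁ (f-injective (trans a (sym a′))))
  ... | inj₂ u | inj₂ u′ | inj₁ _ = same ex ex′ (cong inj₂ (trans (sym a) a′))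
  ... | inj₁ _ | inj₂ _ | inj₁ _ with () ← eq
  ... | inj₂ _ | inj₁ _ | inj₁ _ with () ← eq
  ... | inj₁ _ | inj₂ _ | inj₂ _ with () ← eq
  ... | inj₂ _ | inj₁ _ | inj₂ _ with () ← eq

positions : (ℕ → Bool) → (n : ℕ) → Subset n
positions g zero = []
positions g (suc n) = g 0 ∷ positions (λ t → g (suc t)) n

-- Position n of the pattern is folded onto vertex 0, as on the cycle C_n.
cyclicPositions : (ℕ → Bool) → (n : ℕ) → Subset n
cyclicPositions g zero = []
cyclicPositions g (suc n) = (g 0 ∨ g (suc n)) ∷ positions (λ t → g (suc t)) n

zero∈ : ∀ {n} {b} (p : Subset n) → T b → zero ∈ (b ∷ p)
zero∈ {b = true} p _ = here

∈-positions : ∀ g {n} (i : Fin n) → T (g (toℕ i)) → i ∈ positions g n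
∈-positions g zero gi = zero∈ _ gi
∈-positions g (suc i) gi = there (∈-positions (λ t → g (suc t)) i gi)

zero∈cyclicPositions : ∀ g {n} → T (g 0) ⊎ T (g (suc n)) → zero ∈ cyclicPositions g (suc n)
zero∈cyclicPositions g marked = zero∈ _ (Equivalence.from T-∨ marked)

∈-cyclicPositions : ∀ g {n} (i : Fin n) → T (g (toℕ i)) → i ∈ cyclicPositions g n
∈-cyclicPositions g zero g0 = zero∈cyclicPositions g (inj₁ g0)
∈-cyclicPositions g (suc i) gi = there (∈-positions (λ t → g (suc t)) i gi)

data PathDominated (g : ℕ → Bool) : ℕ → Set where
  here  : ∀ {t} → T (g t) → PathDominated g t
  left  : ∀ {t} → T (g t) → PathDominated g (suc t)
  right : ∀ {t} → T (g (suc t)) → PathDominated g t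

pathDominated-suc : ∀ {g t} → PathDominated (λ s → g (suc s)) t → PathDominated g (suc t)
pathDominated-suc (here gt) = here gt
pathDominated-suc (left gt) = left gt
pathDominated-suc (right gt) = right gt

predecessor : ∀ {n s} (i : Fin n) → toℕ i ≡ suc s → ∃ (λ (j : Fin n) → toℕ j ≡ s)
predecessor {n} {s} i i≡1+s = fromℕ< s<n , toℕ-fromℕ< s<n
  where
  s<n : s < n
  s<n = <-trans (n<1+n s) (subst (_< n) i≡1+s (toℕ<n i))

successor-or-last : ∀ {n} (i : Fin n) → ∃ (λ (j : Fin n) → toℕ j ≡ suc (toℕ i)) ⊎ suc (toℕ i) ≡ n
successor-or-last i = map₁ (λ 1+i<n → fromℕ< 1+i<n , toℕ-fromℕ< 1+i<n) (m≤n⇒m<n∨m≡n (toℕ<n i))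

pathDominated⇒dominatedBy : ∀ g {n} (i : Fin n) → PathDominated g (toℕ i) →
                            DominatedBy (CycleAdj n) (cyclicPositions g n) i
pathDominated⇒dominatedBy g {suc m} i d = go d refl
  where
  S = cyclicPositions g (suc m)

  mark : ∀ {j : Fin (suc m)} {t} → toℕ j ≡ t → T (g t) → j ∈ S
  mark refl = ∈-cyclicPositions g _

  go : ∀ {t} → PathDominated g t → toℕ i ≡ t → DominatedBy (CycleAdj (suc m)) S i
  go (here gi) refl = inj₁ (∈-cyclicPositions g i gi)
  go (left gs) i≡1+s with predecessor i i≡1+s
  ... | j , j≡s = inj₂ (j , mark j≡s gs , inj₂ (inj₁ (trans i≡1+s (cong suc (sym j≡s)))))
  go (right g1+i) refl with successor-or-last i
  ... | inj₁ (j , j≡1+i) = inj₂ (j , mark j≡1+i g1+i , inj₁ (inj₁ j≡1+i))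
  ... | inj₂ 1+i≡n = inj₂ (zero , zero∈cyclicPositions g (inj₂ (subst (λ k → T (g k)) 1+i≡n g1+i)) ,
                           inj₁ (inj₂ (1+i≡n , refl)))

∈-++⁺ˡ : ∀ {m n} {p : Subset m} (q : Subset n) {i} → i ∈ p → (i ↑ˡ n) ∈ (p ++ q)
∈-++⁺ˡ q here = here
∈-++⁺ˡ q (there i∈p) = there (∈-++⁺ˡ q i∈p)

∈-++⁺ʳ : ∀ {m n} (p : Subset m) {q : Subset n} {j} → j ∈ q → (m ↑ʳ j) ∈ (p ++ q)
∈-++⁺ʳ [] j∈q = j∈q
∈-++⁺ʳ (_ ∷ p) j∈q = there (∈-++⁺ʳ p j∈q)

functigraph-dominating : ∀ {N} {A : Fin N → Fin N → Set} {f : Fin N → Fin N} {P Q : Subset N} →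
  (∀ i → DominatedBy A P i ⊎ f i ∈ Q) →
  (∀ j → DominatedBy A Q j ⊎ ∃ (λ i → f i ≡ j × i ∈ P)) →
  Dominating (FunctiAdj A f) (P ++ Q)
functigraph-dominating {N} {A} {f} {P} {Q} upper lower x =
  subst (DominatedBy (FunctiAdj A f) (P ++ Q)) (join-splitAt N N x) (joined (splitAt N x))
  where
  upper-edge : ∀ {i j} → A i j → FunctiAdj A f (i ↑ˡ N) (j ↑ˡ N)
  upper-edge {i} {j} a rewrite splitAt-↑ˡ N i N | splitAt-↑ˡ N j N = a

  lower-edge : ∀ {i j} → A i j → FunctiAdj A f (N ↑ʳ i) (N ↑ʳ j)
  lower-edge {i} {j} a rewrite splitAt-↑ʳ N N i | splitAt-↑ʳ N N j = a

  down-edge : ∀ {i j} → f i ≡ j → FunctiAdj A f (i ↑ˡ N) (N ↑ʳ j)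
  down-edge {i} {j} e rewrite splitAt-↑ˡ N i N | splitAt-↑ʳ N N j = e

  up-edge : ∀ {i j} → f i ≡ j → FunctiAdj A f (N ↑ʳ j) (i ↑ˡ N)
  up-edge {i} {j} e rewrite splitAt-↑ʳ N N j | splitAt-↑ˡ N i N = e

  joined : ∀ p → DominatedBy (FunctiAdj A f) (P ++ Q) (join N N p)
  joined (inj₁ i) with upper i
  ... | inj₁ (inj₁ i∈P) = inj₁ (∈-++⁺ˡ Q i∈P)
  ... | inj₁ (inj₂ (j , j∈P , a)) = inj₂ (j ↑ˡ N , ∈-++⁺ˡ Q j∈P , upper-edge a)
  ... | inj₂ fi∈Q = inj₂ (N ↑ʳ f i , ∈-++⁺ʳ P fi∈Q , down-edge refl)
  joined (inj₂ j) with lower j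
  ... | inj₁ (inj₁ j∈Q) = inj₁ (∈-++⁺ʳ P j∈Q)
  ... | inj₁ (inj₂ (k , k∈Q , a)) = inj₂ (N ↑ʳ k , ∈-++⁺ʳ P k∈Q , lower-edge a)
  ... | inj₂ (i , fi≡j , i∈P) = inj₂ (i ↑ˡ N , ∈-++⁺ˡ Q i∈P , up-edge fi≡j)

indicator : Bool → ℕ
indicator true = 1
indicator false = 0

∣∷∣ : ∀ {n} b (p : Subset n) → ∣ b ∷ p ∣ ≡ indicator b + ∣ p ∣
∣∷∣ true p = refl
∣∷∣ false p = refl

indicator-∨ : ∀ a b → indicator (a ∨ b) ≤ indicator a + indicator b
indicator-∨ true b = s≤s z≤n
indicator-∨ false b = ≤-refl

∣++∣ : ∀ {m n} (p : Subset m) (q : Subset n) → ∣ p ++ q ∣ ≡ ∣ p ∣ + ∣ q ∣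
∣++∣ [] q = refl
∣++∣ (true ∷ p) q = cong suc (∣++∣ p q)
∣++∣ (false ∷ p) q = ∣++∣ p q

∣positions∣-suc : ∀ g n → ∣ positions g (suc n) ∣ ≡ ∣ positions g n ∣ + indicator (g n)
∣positions∣-suc g zero = trans (∣∷∣ (g 0) []) (+-comm (indicator (g 0)) 0)
∣positions∣-suc g (suc n) = begin
  ∣ positions g (suc (suc n)) ∣           ≡⟨ ∣∷∣ (g 0) (positions g′ (suc n)) ⟩
  first + ∣ positions g′ (suc n) ∣         ≡⟨ cong (first +_) (∣positions∣-suc g′ n) ⟩
  first + (∣ positions g′ n ∣ + last)      ≡⟨ +-assoc first ∣ positions g′ n ∣ last ⟨
  first + ∣ positions g′ n ∣ + last        ≡⟨ cong (_+ last) (∣∷∣ (g 0) (positions g′ n)) ⟨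
  ∣ positions g (suc n) ∣ + last           ∎
  where
  open ≡-Reasoning
  g′ : ℕ → Bool
  g′ t = g (suc t)
  first = indicator (g 0)
  last = indicator (g (suc n))

∣cyclicPositions∣≤∣positions∣ : ∀ g n → ∣ cyclicPositions g n ∣ ≤ ∣ positions g (suc n) ∣
∣cyclicPositions∣≤∣positions∣ g zero = z≤n
∣cyclicPositions∣≤∣positions∣ g (suc n) = begin
  ∣ cyclicPositions g (suc n) ∣          ≡⟨ ∣∷∣ (g 0 ∨ g (suc n)) P ⟩
  indicator (g 0 ∨ g (suc n)) + ∣ P ∣     ≤⟨ +-monoˡ-≤ ∣ P ∣ (indicator-∨ (g 0) (g (suc n))) ⟩
  first + last + ∣ P ∣                   ≡⟨ +-assoc first last ∣ P ∣ ⟩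
  first + (last + ∣ P ∣)                 ≡⟨ cong (first +_) (+-comm last ∣ P ∣) ⟩
  first + (∣ P ∣ + last)                 ≡⟨ cong (first +_) (∣positions∣-suc g′ n) ⟨
  first + ∣ positions g′ (suc n) ∣        ≡⟨ ∣∷∣ (g 0) (positions g′ (suc n)) ⟨
  ∣ positions g (suc (suc n)) ∣          ∎
  where
  open ≤-Reasoning
  g′ : ℕ → Bool
  g′ t = g (suc t)
  P = positions g′ n
  first = indicator (g 0)
  last = indicator (g (suc n))

mod3≡1 : ℕ → Bool
mod3≡1 0 = false
mod3≡1 1 = true
mod3≡1 2 = false
mod3≡1 (suc (suc (suc t))) = mod3≡1 t

mod4≡0 : ℕ → Bool
mod4≡0 0 = true
mod4≡0 1 = false
mod4≡0 2 = false
mod4≡0 3 = false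
mod4≡0 (suc (suc (suc (suc t)))) = mod4≡0 t

mod4≡2 : ℕ → Bool
mod4≡2 0 = false
mod4≡2 1 = false
mod4≡2 2 = true
mod4≡2 3 = false
mod4≡2 (suc (suc (suc (suc t)))) = mod4≡2 t

mod3≡1-pathDominates : ∀ t → PathDominated mod3≡1 t
mod3≡1-pathDominates 0 = right _
mod3≡1-pathDominates 1 = here _
mod3≡1-pathDominates 2 = left _
mod3≡1-pathDominates (suc (suc (suc t))) =
  pathDominated-suc (pathDominated-suc (pathDominated-suc (mod3≡1-pathDominates t)))

pathDominated-+4 : ∀ {g t} → PathDominated (λ s → g (4 + s)) t → PathDominated g (4 + t)
pathDominated-+4 d = pathDominated-suc (pathDominated-suc (pathDominated-suc (pathDominated-suc d)))

mod4≡0-pathDominates-or-mod4≡2 : ∀ t → PathDominated mod4≡0 t ⊎ T (mod4≡2 t)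
mod4≡0-pathDominates-or-mod4≡2 0 = inj₁ (here _)
mod4≡0-pathDominates-or-mod4≡2 1 = inj₁ (left _)
mod4≡0-pathDominates-or-mod4≡2 2 = inj₂ _
mod4≡0-pathDominates-or-mod4≡2 3 = inj₁ (right _)
mod4≡0-pathDominates-or-mod4≡2 (suc (suc (suc (suc t)))) =
  map₁ pathDominated-+4 (mod4≡0-pathDominates-or-mod4≡2 t)

mod4≡2-pathDominates-or-mod4≡0 : ∀ t → PathDominated mod4≡2 t ⊎ T (mod4≡0 t)
mod4≡2-pathDominates-or-mod4≡0 0 = inj₂ _
mod4≡2-pathDominates-or-mod4≡0 1 = inj₁ (right _)
mod4≡2-pathDominates-or-mod4≡0 2 = inj₁ (here _)
mod4≡2-pathDominates-or-mod4≡0 3 = inj₁ (left _)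
mod4≡2-pathDominates-or-mod4≡0 (suc (suc (suc (suc t)))) =
  map₁ pathDominated-+4 (mod4≡2-pathDominates-or-mod4≡0 t)

3*∣positions-mod3≡1∣≤n+1 : ∀ n → 3 * ∣ positions mod3≡1 n ∣ ≤ n + 1
3*∣positions-mod3≡1∣≤n+1 0 = z≤n
3*∣positions-mod3≡1∣≤n+1 1 = z≤n
3*∣positions-mod3≡1∣≤n+1 2 = ≤-refl
3*∣positions-mod3≡1∣≤n+1 (suc (suc (suc n))) =
  ≤-trans (≤-reflexive (*-suc 3 ∣ positions mod3≡1 n ∣)) (+-monoʳ-≤ 3 (3*∣positions-mod3≡1∣≤n+1 n))

2*∣positions-mod4≡0,2∣≤n+1 : ∀ n → 2 * (∣ positions mod4≡0 n ∣ + ∣ positions mod4≡2 n ∣) ≤ n + 1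
2*∣positions-mod4≡0,2∣≤n+1 0 = z≤n
2*∣positions-mod4≡0,2∣≤n+1 1 = ≤-refl
2*∣positions-mod4≡0,2∣≤n+1 2 = n≤1+n 2
2*∣positions-mod4≡0,2∣≤n+1 3 = ≤-refl
2*∣positions-mod4≡0,2∣≤n+1 (suc (suc (suc (suc n)))) = begin
  2 * (suc a + suc b)   ≡⟨ cong (λ k → 2 * suc k) (+-suc a b) ⟩
  2 * (2 + (a + b))     ≡⟨ *-distribˡ-+ 2 2 (a + b) ⟩
  4 + 2 * (a + b)       ≤⟨ +-monoʳ-≤ 4 (2*∣positions-mod4≡0,2∣≤n+1 n) ⟩
  4 + (n + 1)           ∎
  where
  open ≤-Reasoning
  a = ∣ positions mod4≡0 n ∣
  b = ∣ positions mod4≡2 n ∣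

Prism : (n : ℕ) → Fin (n + n) → Fin (n + n) → Set
Prism n = FunctiAdj (CycleAdj n) (λ (i : Fin n) → i)

cycleDominatingSet : (n : ℕ) → Subset n
cycleDominatingSet = cyclicPositions mod3≡1

prismDominatingSet : (n : ℕ) → Subset (n + n)
prismDominatingSet n = cyclicPositions mod4≡0 n ++ cyclicPositions mod4≡2 n

cycleDominatingSet-dominating : ∀ n → Dominating (CycleAdj n) (cycleDominatingSet n)
cycleDominatingSet-dominating n i = pathDominated⇒dominatedBy mod3≡1 i (mod3≡1-pathDominates (toℕ i))

prismDominatingSet-dominating : ∀ n → Dominating (Prism n) (prismDominatingSet n)
prismDominatingSet-dominating n = functigraph-dominating upper lower
  where
  upper : ∀ i → DominatedBy (CycleAdj n) (cyclicPositions mod4≡0 n) i ⊎ i ∈ cyclicPositions mod4≡2 n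
  upper i with mod4≡0-pathDominates-or-mod4≡2 (toℕ i)
  ... | inj₁ d = inj₁ (pathDominated⇒dominatedBy mod4≡0 i d)
  ... | inj₂ m = inj₂ (∈-cyclicPositions mod4≡2 i m)

  lower : ∀ j → DominatedBy (CycleAdj n) (cyclicPositions mod4≡2 n) j ⊎
                ∃ (λ i → i ≡ j × i ∈ cyclicPositions mod4≡0 n)
  lower j with mod4≡2-pathDominates-or-mod4≡0 (toℕ j)
  ... | inj₁ d = inj₁ (pathDominated⇒dominatedBy mod4≡2 j d)
  ... | inj₂ m = inj₂ (j , refl , ∈-cyclicPositions mod4≡0 j m)

3*∣cycleDominatingSet∣≤n+2 : ∀ n → 3 * ∣ cycleDominatingSet n ∣ ≤ n + 2
3*∣cycleDominatingSet∣≤n+2 n = begin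
  3 * ∣ cyclicPositions mod3≡1 n ∣ ≤⟨ *-monoʳ-≤ 3 (∣cyclicPositions∣≤∣positions∣ mod3≡1 n) ⟩
  3 * ∣ positions mod3≡1 (suc n) ∣ ≤⟨ 3*∣positions-mod3≡1∣≤n+1 (suc n) ⟩
  suc n + 1                       ≡⟨ +-suc n 1 ⟨
  n + 2                           ∎
  where open ≤-Reasoning

2*∣prismDominatingSet∣≤n+2 : ∀ n → 2 * ∣ prismDominatingSet n ∣ ≤ n + 2
2*∣prismDominatingSet∣≤n+2 n = begin
  2 * ∣ P ++ Q ∣           ≡⟨ cong (2 *_) (∣++∣ P Q) ⟩
  2 * (∣ P ∣ + ∣ Q ∣)       ≤⟨ *-monoʳ-≤ 2 (+-mono-≤ (∣cyclicPositions∣≤∣positions∣ mod4≡0 n)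
                                                     (∣cyclicPositions∣≤∣positions∣ mod4≡2 n)) ⟩
  2 * (∣ positions mod4≡0 (suc n) ∣ + ∣ positions mod4≡2 (suc n) ∣)
                          ≤⟨ 2*∣positions-mod4≡0,2∣≤n+1 (suc n) ⟩
  suc n + 1               ≡⟨ +-suc n 1 ⟨
  n + 2                   ∎
  where
  open ≤-Reasoning
  P = cyclicPositions mod4≡0 n
  Q = cyclicPositions mod4≡2 n

domination-number-≥ : ∀ {N d γ} {A : Fin N → Fin N → Set} →
                      IsDominationNumber A γ → PortNumbering A d → N ≤ suc d * γ
domination-number-≥ {N} {d} ((S , dom , ∣S∣≡γ) , _) ports =
  subst (λ k → N ≤ suc d * k) ∣S∣≡γ (dominating⇒≤[1+d]*∣S∣ ports dom)

domination-number-≤ : ∀ {N γ} {A : Fin N → Fin N → Set} {S : Subset N} →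
                      IsDominationNumber A γ → Dominating A S → γ ≤ ∣ S ∣
domination-number-≤ (_ , minimal) = minimal _

module _ (n : ℕ) {γ : ℕ} where

  cycle-γ-lower : IsDominationNumber (CycleAdj n) γ → n ≤ 3 * γ
  cycle-γ-lower isγ = domination-number-≥ isγ (cycle-ports n)

  cycle-γ≤∣cycleDominatingSet∣ : IsDominationNumber (CycleAdj n) γ → γ ≤ ∣ cycleDominatingSet n ∣
  cycle-γ≤∣cycleDominatingSet∣ isγ = domination-number-≤ isγ (cycleDominatingSet-dominating n)

  cycle-γ-upper : IsDominationNumber (CycleAdj n) γ → 3 * γ ≤ n + 2
  cycle-γ-upper isγ =
    ≤-trans (*-monoʳ-≤ 3 (cycle-γ≤∣cycleDominatingSet∣ isγ)) (3*∣cycleDominatingSet∣≤n+2 n)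

  prism-γ-lower : IsDominationNumber (Prism n) γ → n ≤ 2 * γ
  prism-γ-lower isγ = *-cancelˡ-≤ 2 (begin
    2 * n         ≡⟨ cong (n +_) (+-identityʳ n) ⟩
    n + n         ≤⟨ domination-number-≥ isγ (functigraph-ports (cycle-ports n) id) ⟩
    4 * γ         ≡⟨ *-assoc 2 2 γ ⟩
    2 * (2 * γ)   ∎)
    where open ≤-Reasoning

  prism-γ≤∣prismDominatingSet∣ : IsDominationNumber (Prism n) γ → γ ≤ ∣ prismDominatingSet n ∣
  prism-γ≤∣prismDominatingSet∣ isγ = domination-number-≤ isγ (prismDominatingSet-dominating n)

  prism-γ-upper : IsDominationNumber (Prism n) γ → 2 * γ ≤ n + 2
  prism-γ-upper isγ =
    ≤-trans (*-monoʳ-≤ 2 (prism-γ≤∣prismDominatingSet∣ isγ)) (2*∣prismDominatingSet∣≤n+2 n)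

CycleAdj? : ∀ n → Decidable (CycleAdj n)
CycleAdj? n i j = successor? i j ⊎-dec successor? j i
  where
  successor? : ∀ a b → Dec (Successor n a b)
  successor? a b = (toℕ b ≟ suc (toℕ a)) ⊎-dec ((suc (toℕ a) ≟ n) ×-dec (toℕ b ≟ 0))

FunctiAdj? : ∀ {N} {A : Fin N → Fin N → Set} → Decidable A → (f : Fin N → Fin N) →
             Decidable (FunctiAdj A f)
FunctiAdj? {N} A? f x y with splitAt N x | splitAt N y
... | inj₁ a | inj₁ b = A? a b
... | inj₂ a | inj₂ b = A? a b
... | inj₁ a | inj₂ b = f a Fin.≟ b
... | inj₂ a | inj₁ b = f b Fin.≟ a

Dominating? : ∀ {N} {A : Fin N → Fin N → Set} → Decidable A → ∀ S → Dec (Dominating A S)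
Dominating? A? S = all? λ x → (x ∈? S) ⊎-dec any? (λ y → (y ∈? S) ×-dec A? x y)

-- The port bound only gives γ ≥ 3 here; the remaining case is settled by searching all 2¹² subsets.
prism₆-γ-lower : ∀ {γ} → IsDominationNumber (Prism 6) γ → 4 ≤ γ
prism₆-γ-lower ((S , dom , ∣S∣≡γ) , _) =
  subst (4 ≤_) ∣S∣≡γ (≰⇒> λ ∣S∣≤3 → no-small-dominating-set (S , ∣S∣≤3 , dom))
  where
  no-small-dominating-set : ¬ ∃ (λ S → ∣ S ∣ ≤ 3 × Dominating (Prism 6) S)
  no-small-dominating-set =
    from-no (anySubset? λ S → (∣ S ∣ ≤? 3) ×-dec Dominating? (FunctiAdj? (CycleAdj? 6) (λ i → i)) S)

γ≤2 : ∀ k {n γ} → suc k * γ ≤ n + 2 → n ≤ k * γ → γ ≤ 2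
γ≤2 k {n} {γ} [1+k]γ≤n+2 n≤kγ = +-cancelʳ-≤ (k * γ) γ 2 (begin
  γ + k * γ   ≤⟨ [1+k]γ≤n+2 ⟩
  n + 2       ≤⟨ +-monoˡ-≤ 2 n≤kγ ⟩
  k * γ + 2   ≡⟨ +-comm (k * γ) 2 ⟩
  2 + k * γ   ∎)
  where open ≤-Reasoning

same-γ⇒n≡4 : ∀ {n γ} → 3 ≤ n → n ≤ 2 * γ → 3 * γ ≤ n + 2 → n ≡ 4
same-γ⇒n≡4 {n} {γ} 3≤n n≤2γ 3γ≤n+2 = cases γ (γ≤2 2 3γ≤n+2 n≤2γ) n≤2γ 3γ≤n+2
  where
  cases : ∀ γ → γ ≤ 2 → n ≤ 2 * γ → 3 * γ ≤ n + 2 → n ≡ 4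
  cases 0 _ n≤0 _ with () ← ≤-trans 3≤n n≤0
  cases 1 _ n≤2 _ = ⊥-elim (<-irrefl refl (≤-trans 3≤n n≤2))
  cases 2 _ n≤4 6≤n+2 = ≤-antisym n≤4 (+-cancelʳ-≤ 2 4 n 6≤n+2)
  cases (suc (suc (suc _))) (s≤s (s≤s ())) _ _

double-γ⇒n≡3⊎n≡6 : ∀ {n γ} → 3 ≤ n → n ≤ 3 * γ → 2 * (2 * γ) ≤ n + 2 → n ≡ 3 ⊎ n ≡ 6
double-γ⇒n≡3⊎n≡6 {n} {γ} 3≤n n≤3γ 4γ≤n+2 =
  cases γ (γ≤2 3 (subst (_≤ n + 2) (sym (*-assoc 2 2 γ)) 4γ≤n+2) n≤3γ) n≤3γ 4γ≤n+2
  where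
  cases : ∀ γ → γ ≤ 2 → n ≤ 3 * γ → 2 * (2 * γ) ≤ n + 2 → n ≡ 3 ⊎ n ≡ 6
  cases 0 _ n≤0 _ with () ← ≤-trans 3≤n n≤0
  cases 1 _ n≤3 _ = inj₁ (≤-antisym n≤3 3≤n)
  cases 2 _ n≤6 8≤n+2 = inj₂ (≤-antisym n≤6 (+-cancelʳ-≤ 2 6 n 8≤n+2))
  cases (suc (suc (suc _))) (s≤s (s≤s ())) _ _

squeeze : ∀ k d {m γ} → k * d < m → m ≤ k * γ → γ ≤ suc d → γ ≡ suc d
squeeze k d kd<m m≤kγ γ≤1+d = ≤-antisym γ≤1+d (*-cancelˡ-< k d _ (<-≤-trans kd<m m≤kγ))

module _ {γ : ℕ} where

  cycle₃-γ : IsDominationNumber (CycleAdj 3) γ → γ ≡ 1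
  cycle₃-γ isγ = squeeze 3 0 (s≤s z≤n) (cycle-γ-lower 3 isγ) (cycle-γ≤∣cycleDominatingSet∣ 3 isγ)

  cycle₄-γ : IsDominationNumber (CycleAdj 4) γ → γ ≡ 2
  cycle₄-γ isγ = squeeze 3 1 ≤-refl (cycle-γ-lower 4 isγ) (cycle-γ≤∣cycleDominatingSet∣ 4 isγ)

  cycle₆-γ : IsDominationNumber (CycleAdj 6) γ → γ ≡ 2
  cycle₆-γ isγ = squeeze 3 1 (m≤m+n 4 2) (cycle-γ-lower 6 isγ) (cycle-γ≤∣cycleDominatingSet∣ 6 isγ)

  prism₃-γ : IsDominationNumber (Prism 3) γ → γ ≡ 2
  prism₃-γ isγ = squeeze 2 1 ≤-refl (prism-γ-lower 3 isγ) (prism-γ≤∣prismDominatingSet∣ 3 isγ)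

  prism₄-γ : IsDominationNumber (Prism 4) γ → γ ≡ 2
  prism₄-γ isγ = squeeze 2 1 (n≤1+n 3) (prism-γ-lower 4 isγ) (prism-γ≤∣prismDominatingSet∣ 4 isγ)

  prism₆-γ : IsDominationNumber (Prism 6) γ → γ ≡ 4
  prism₆-γ isγ = ≤-antisym (prism-γ≤∣prismDominatingSet∣ 6 isγ) (prism₆-γ-lower isγ)

corollary3p6 : (n : ℕ) → 3 ≤ n → (γC γF : ℕ) →
    IsDominationNumber (CycleAdj n) γC →
    IsDominationNumber (FunctiAdj (CycleAdj n) (λ (i : Fin n) → i)) γF →
    ((γF ≡ γC) ⇔ (n ≡ 4)) × ((γF ≡ 2 * γC) ⇔ ((n ≡ 3) ⊎ (n ≡ 6)))
corollary3p6 n 3≤n γC γF isC isF = mk⇔ same⇒n≡4 n≡4⇒same , mk⇔ double⇒n≡3⊎n≡6 n≡3⊎n≡6⇒double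
  where
  same⇒n≡4 : γF ≡ γC → n ≡ 4
  same⇒n≡4 refl = same-γ⇒n≡4 {γ = γC} 3≤n (prism-γ-lower n isF) (cycle-γ-upper n isC)

  n≡4⇒same : n ≡ 4 → γF ≡ γC
  n≡4⇒same refl = trans (prism₄-γ isF) (sym (cycle₄-γ isC))

  double⇒n≡3⊎n≡6 : γF ≡ 2 * γC → n ≡ 3 ⊎ n ≡ 6
  double⇒n≡3⊎n≡6 refl = double-γ⇒n≡3⊎n≡6 {γ = γC} 3≤n (cycle-γ-lower n isC) (prism-γ-upper n isF)

  n≡3⊎n≡6⇒double : n ≡ 3 ⊎ n ≡ 6 → γF ≡ 2 * γC
  n≡3⊎n≡6⇒double (inj₁ refl) = trans (prism₃-γ isF) (cong (2 *_) (sym (cycle₃-γ isC)))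
  n≡3⊎n≡6⇒double (inj₂ refl) = trans (prism₆-γ isF) (cong (2 *_) (sym (cycle₆-γ isC)))
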